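{- Let $B = M \cup \{\omega_1,\ldots,\omega_p\}$ be a basis, where $M$ is the set of all monotone Boolean functions, $p\ge1$, and $\omega_1,\ldots,\omega_p$ are non-monotone Boolean functions; let $r(B)=\max\{d(\omega_1),\ldots,d(\omega_p)\}$ and $c(B)=\log_2(2r(B)+1)+1$. Then for every system $F=\{f_1(x_1,\ldots,x_n),\ldots,f_m(x_1,\ldots,x_n)\}$ of Boolean functions $$I_B(F)\ge \lceil \log_2(d(F)+1)\rceil - c(B).$$
   Context: Boolean functions are maps $E_2^n\to E_2$ with $E_2=\{0,1\}$. An increasing chain is a sequence of pairwise distinct tuples $\tilde\alpha_1,\ldots,\tilde\alpha_r\in E_2^n$ with $\tilde\alpha_i\le\tilde\alpha_{i+1}$ componentwise for $i=1,\ldots,r-1$. For a Boolean function $f$, an ordered pair $(\tilde\alpha,\tilde\beta)$ of tuples in $E_2^n$ is a jump of $f$ if $\tilde\alpha\le\tilde\beta$ componentwise and $f(\tilde\alpha)>f(\tilde\beta)$. For a system $F$ of Boolean functions of $x_1,\ldots,x_n$, a pair is a jump for $F$ if it is a jump for some $f\in F$. For a chain $C=(\tilde\alpha_1,\ldots,\tilde\alpha_r)$, $d_C(F)$ is the number of indices $i\in\{1,\ldots,r-1\}$ such that $(\tilde\alpha_i,\tilde\alpha_{i+1})$ is a jump for $F$; the decrease $d(F)$ is the maximum of $d_C(F)$ over all increasing chains $C$, and $d(f)=d(\{f\})$. Circuits over $B$ have gates computing functions of $B$; gates computing functions of $M$ have weight $0$, gates computing $\omega_1,\ldots,\omega_p$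 have weight $1$. The inversion complexity $I_B(F)$ is the minimum, over all circuits over $B$ with inputs $x_1,\ldots,x_n$ realizing all functions of $F$, of the number of gates computing functions from $\{\omega_1,\ldots,\omega_p\}$. -}

module Defs where

open import Data.Bool using (Bool; true; false; _≤_)
open import Data.Bool.Properties using (_≤?_) renaming (_≟_ to _≟ᵇ_)
open import Data.Nat using (ℕ; zero; suc; _+_) renaming (_≤_ to _≤ℕ_)
open import Data.Fin using (Fin)
open import Data.Fin.Properties using (any?)
open import Data.Vec using (Vec; _∷_; []; map)
open import Data.Vec.Relation.Binary.Pointwise.Inductive as PW using (Pointwise)
open import Data.List using (List; _∷_; [])
open import Data.List.Relation.Unary.Linked using (Linked)
open import Data.List.Relation.Unary.AllPairs using (AllPairs)
open import Data.Product using (Σ; _×_; _,_)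
open import Relation.Binary.PropositionalEquality using (_≡_; _≢_)
open import Relation.Nullary using (Dec; ¬_)
open import Relation.Nullary.Decidable using (isYes; _×-dec_)

Tuple : ℕ → Set
Tuple n = Vec Bool n

BF : ℕ → Set
BF n = Tuple n → Bool

_≤ᵗ_ : ∀ {n} → Tuple n → Tuple n → Set
_≤ᵗ_ = Pointwise _≤_

_≤ᵗ?_ : ∀ {n} (α β : Tuple n) → Dec (α ≤ᵗ β)
_≤ᵗ?_ = PW.decidable _≤?_

Monotone : ∀ {a} → BF a → Set
Monotone g = ∀ α β → α ≤ᵗ β → g α ≤ g β

System : ℕ → ℕ → Set
System m n = Fin m → BF n

single : ∀ {n} → BF n → System 1 n
single f _ = f

Jump : ∀ {m n} → System m n → Tuple n → Tuple n → Set
Jump {m} F α β = α ≤ᵗ β × Σ (Fin m) (λ j → F j α ≡ true × F j β ≡ false)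

jump? : ∀ {m n} (F : System m n) α β → Dec (Jump F α β)
jump? F α β = (α ≤ᵗ? β) ×-dec any? (λ j → (F j α ≟ᵇ true) ×-dec (F j β ≟ᵇ false))

IsIncreasingChain : ∀ {n} → List (Tuple n) → Set
IsIncreasingChain C = Linked _≤ᵗ_ C × AllPairs _≢_ C

dC : ∀ {m n} → System m n → List (Tuple n) → ℕ
dC F [] = 0
dC F (α ∷ []) = 0
dC F (α ∷ β ∷ C) = (if′ (isYes (jump? F α β))) + dC F (β ∷ C)
  where
  if′ : Bool → ℕ
  if′ true = 1
  if′ false = 0

IsDecrease : ∀ {m n} → System m n → ℕ → Set
IsDecrease {m} {n} F k =
  Σ (List (Tuple n)) (λ C → IsIncreasingChain C × dC F C ≡ k)
  × (∀ C → IsIncreasingChain C → dC F C ≤ℕ k)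

IsMaxOf : ∀ {p} → (Fin p → ℕ) → ℕ → Set
IsMaxOf {p} v r = Σ (Fin p) (λ i → v i ≡ r) × (∀ i → v i ≤ℕ r)

-- The extra functions ω₁,…,ω_p of a basis B = M ∪ {ω₁,…,ω_p}
record Basis : Set where
  field
    p  : ℕ
    ar : Fin p → ℕ
    ω  : (i : Fin p) → BF (ar i)
open Basis public

data GateKind (B : Basis) : ℕ → Set where
  mono  : ∀ {a} (g : BF a) → Monotone g → GateKind B a
  omega : (i : Fin (p B)) → GateKind B (ar B i)

kindFun : ∀ {B a} → GateKind B a → BF a
kindFun (mono g _) = g
kindFun {B} (omega i) = ω B i

weight : ∀ {B a} → GateKind B a → ℕ
weight (mono _ _) = 0
weight (omega _) = 1

-- a gate in a circuit with s nodes already present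
record Gate (B : Basis) (s : ℕ) : Set where
  constructor gate
  field
    arity  : ℕ
    kind   : GateKind B arity
    inputs : Vec (Fin s) arity
open Gate public

-- Circuit B n s : a circuit over B with inputs x₁,…,xₙ and s nodes in total
-- (the n inputs followed by gates in topological order)
data Circuit (B : Basis) (n : ℕ) : ℕ → Set where
  inputsOnly : Circuit B n n
  _▷_ : ∀ {s} → Circuit B n s → Gate B s → Circuit B n (suc s)

-- values of all nodes on input α (most recently added node first)
eval : ∀ {B n s} → Circuit B n s → Tuple n → Vec Bool s
eval inputsOnly α = α
eval (c ▷ g) α = kindFun (kind g) (map (Data.Vec.lookup (eval c α)) (inputs g)) ∷ eval c α

nodeFun : ∀ {B n s} → Circuit B n s → Fin s → BF n
nodeFun c v α = Data.Vec.lookup (eval c α) v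

invCount : ∀ {B n s} → Circuit B n s → ℕ
invCount inputsOnly = 0
invCount (c ▷ g) = weight (kind g) + invCount c

Realizes : ∀ {B n s m} → Circuit B n s → System m n → Set
Realizes {s = s} c F = ∀ j → Σ (Fin s) (λ v → ∀ α → nodeFun c v α ≡ F j α)

IsInversionComplexity : ∀ {m n} → Basis → System m n → ℕ → Set
IsInversionComplexity {m} {n} B F k =
  Σ ℕ (λ s → Σ (Circuit B n s) (λ c → Realizes c F × invCount c ≡ k))
  × (∀ s (c : Circuit B n s) → Realizes c F → k ≤ℕ invCount c)

-- Fix a chain C on which F has d(F) jumps and a circuit c with I = I_B(F) gates
-- computing ω's. At each jump of F along C the vector of all node values of c
-- fails to increase. Add the gates of c one at a time from the inputs, tracking
-- lists along which the node values built so far increase: a monotone gate keeps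
-- such a list increasing, while an ω-gate sees increasing arguments, so its value
-- changes at most 2 d(ω) + 1 ≤ K = 2 r(B) + 1 times; cutting the list into the two
-- sublists on which that gate is constant shows that the number D of non-increasing
-- steps satisfies D + K ≤ K · 2^w after w ω-gates. So d(F) + 1 ≤ K · 2^I, and
-- 2^⌈log₂(d(F)+1)⌉ ≤ 2 (d(F) + 1) ≤ K · 2^(I+1).
module Submission where

open import Defs
open import Data.Nat using (ℕ; zero; suc; _+_; _*_; _^_; _≤_; z≤n; s≤s)
open import Data.Nat.Logarithm using (⌈log₂_⌉; ⌈log₂⌉-mono-≤; ⌈log₂2^n⌉≡n)
open import Data.Fin using (Fin; zero)
open import Relation.Nullary using (¬_; yes; no)

open import Data.Bool using (Bool; true; false; not; _∧_; _xor_; if_then_else_; T)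
import Data.Bool as Bool
open import Data.Bool.Properties using (∧-inverseʳ)
  renaming (≤-trans to ≤ᵇ-trans; ≤-antisym to ≤ᵇ-antisym; ≤-reflexive to ≤ᵇ-reflexive)
open import Data.Empty using (⊥-elim)
open import Data.List using (List; []; _∷_; map)
open import Data.List.Relation.Unary.Linked as Linked using (Linked; []; [-]; _∷_)
open import Data.List.Relation.Unary.Linked.Properties using (Linked⇒AllPairs; map⁺)
import Data.List.Relation.Unary.AllPairs as AllPairs
open import Data.Nat.Properties
  using (≤-refl; ≤-trans; ≤-reflexive; ≤-antisym; ≤-pred; ≰⇒>; _≤?_;
         n≤1+n; m≤n⇒m≤1+n; m≤n+m; m≤n*m;
         +-suc; +-comm; +-assoc; +-identityʳ; *-identityʳ; *-suc; ^-distribˡ-+-*;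
         +-mono-≤; +-monoˡ-≤; +-monoʳ-≤; *-monoʳ-≤; ^-monoʳ-≤; module ≤-Reasoning)
open import Data.Nat.Tactic.RingSolver using (solve-∀)
open import Data.Product using (Σ; _×_; _,_; proj₁; proj₂)
open import Data.Vec using (lookup)
import Data.Vec as Vec
open import Data.Vec.Properties using (≡-dec)
open import Data.Vec.Relation.Binary.Pointwise.Inductive as Pointwise using ([]; _∷_)
open import Function using (_∘_)
open import Relation.Binary.Definitions using (Transitive; DecidableEquality)
open import Relation.Binary.PropositionalEquality
open import Relation.Nullary.Decidable using (isYes; isNo; fromWitness; toWitness; fromWitnessFalse; toWitnessFalse)

private
  variable
    A A′ : Set

countAdjacent : (A → A → Bool) → List A → ℕ
countAdjacent P [] = 0
countAdjacent P (x ∷ []) = 0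
countAdjacent P (x ∷ y ∷ xs) =
  if P x y then suc (countAdjacent P (y ∷ xs)) else countAdjacent P (y ∷ xs)

changes : (A → Bool) → List A → ℕ
changes u = countAdjacent (λ x y → u x xor u y)

drops : (A → Bool) → List A → ℕ
drops u = countAdjacent (λ x y → u x ∧ not (u y))

fibre : (A → Bool) → Bool → List A → List A
fibre u k [] = []
fibre u k (x ∷ xs) = if u x xor k then fibre u k xs else x ∷ fibre u k xs

countAdjacent-∷ : ∀ (P : A → A → Bool) x xs → countAdjacent P xs ≤ countAdjacent P (x ∷ xs)
countAdjacent-∷ P x [] = z≤n
countAdjacent-∷ P x (y ∷ xs) with P x y
... | true  = n≤1+n _
... | false = ≤-refl

countAdjacent-∷-≤suc : ∀ (P : A → A → Bool) x xs → countAdjacent P (x ∷ xs) ≤ suc (countAdjacent P xs)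
countAdjacent-∷-≤suc P x [] = z≤n
countAdjacent-∷-≤suc P x (y ∷ xs) with P x y
... | true  = ≤-refl
... | false = n≤1+n _

countAdjacent-mono : ∀ {R : A → A → Set} {P Q : A → A → Bool} {xs} →
                     (∀ {x y} → R x y → T (P x y) → T (Q x y)) →
                     Linked R xs → countAdjacent P xs ≤ countAdjacent Q xs
countAdjacent-mono P⇒Q [] = z≤n
countAdjacent-mono P⇒Q [-] = z≤n
countAdjacent-mono {P = P} {Q} {x ∷ y ∷ xs} P⇒Q (r ∷ rs)
  with P x y | Q x y | P⇒Q r | countAdjacent-mono P⇒Q rs
... | true  | true  | _    | ih = s≤s ih
... | true  | false | P⇒Q′ | _  = ⊥-elim (P⇒Q′ _)
... | false | true  | _    | ih = m≤n⇒m≤1+n ih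
... | false | false | _    | ih = ih

countAdjacent≡0 : ∀ {P : A → A → Bool} {xs} → Linked (λ x y → ¬ T (P x y)) xs → countAdjacent P xs ≡ 0
countAdjacent≡0 [] = refl
countAdjacent≡0 [-] = refl
countAdjacent≡0 {P = P} {x ∷ y ∷ xs} (¬Pxy ∷ rs) with P x y
... | true  = ⊥-elim (¬Pxy _)
... | false = countAdjacent≡0 rs

countAdjacent-map : ∀ (P : A′ → A′ → Bool) (f : A → A′) xs →
                    countAdjacent P (map f xs) ≡ countAdjacent (λ x y → P (f x) (f y)) xs
countAdjacent-map P f [] = refl
countAdjacent-map P f (x ∷ []) = refl
countAdjacent-map P f (x ∷ y ∷ xs) with P (f x) (f y) | countAdjacent-map P f (y ∷ xs)
... | true  | ih = cong suc ih
... | false | ih = ih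

private
  suc-≤-+-suc : ∀ {a b c} d {b′ c′} → a ≤ b + c + d → b ≤ b′ → c ≤ c′ →
                suc a ≤ b′ + c′ + suc d
  suc-≤-+-suc d {b′} {c′} a≤ b≤ c≤ =
    ≤-trans (s≤s (≤-trans a≤ (+-monoˡ-≤ d (+-mono-≤ b≤ c≤))))
            (≤-reflexive (sym (+-suc (b′ + c′) d)))

  suc-≤-+-sucᵐ : ∀ {a} b c d → a ≤ b + c + d → suc a ≤ b + suc c + d
  suc-≤-+-sucᵐ {a} b c d a≤ = subst (suc a ≤_) (cong (_+ d) (sym (+-suc b c))) (s≤s a≤)

-- An adjacent pair with equal u-values stays adjacent in its fibre; any other pair is a change of u.
countAdjacent-fibres : ∀ (P : A → A → Bool) (u : A → Bool) xs →
  countAdjacent P xs ≤ countAdjacent P (fibre u false xs) + countAdjacent P (fibre u true xs) + changes u xs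
countAdjacent-fibres P u [] = z≤n
countAdjacent-fibres P u (x ∷ []) = z≤n
countAdjacent-fibres P u (x ∷ y ∷ xs) with u x | u y | countAdjacent-fibres P u (y ∷ xs)
... | false | false | ih with P x y
...   | true  = s≤s ih
...   | false = ih
countAdjacent-fibres P u (x ∷ y ∷ xs) | true | true | ih with P x y
...   | true  = suc-≤-+-sucᵐ (countAdjacent P (fibre u false xs)) _ (changes u (y ∷ xs)) ih
...   | false = ih
countAdjacent-fibres P u (x ∷ y ∷ xs) | false | true | ih =
  ≤-trans (countAdjacent-∷-≤suc P x (y ∷ xs))
          (suc-≤-+-suc (changes u (y ∷ xs)) ih (countAdjacent-∷ P x (fibre u false xs)) ≤-refl)
countAdjacent-fibres P u (x ∷ y ∷ xs) | true | false | ih =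
  ≤-trans (countAdjacent-∷-≤suc P x (y ∷ xs))
          (suc-≤-+-suc (changes u (y ∷ xs)) ih ≤-refl (countAdjacent-∷ P x (fibre u true xs)))

module _ {A : Set} (u : A → Bool) where

  -- Changes of u alternate between rises and drops, and a rise comes first only if u starts at false.
  private
    start : A → ℕ
    start x = if u x then 0 else 1

    start≤1 : ∀ x → start x ≤ 1
    start≤1 x with u x
    ... | true  = z≤n
    ... | false = ≤-refl

    1+[2*d+1]≡2*[1+d]+0 : ∀ d → suc (2 * d + 1) ≡ 2 * suc d + 0
    1+[2*d+1]≡2*[1+d]+0 = solve-∀

    changes≤2*drops+start : ∀ x xs → changes u (x ∷ xs) ≤ 2 * drops u (x ∷ xs) + start x
    changes≤2*drops+start x [] = z≤n
    changes≤2*drops+start x (y ∷ xs) with u x | u y | changes≤2*drops+start y xs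
    ... | true  | true  | ih = ih
    ... | false | false | ih = ih
    ... | true  | false | ih =
      subst (suc (changes u (y ∷ xs)) ≤_) (1+[2*d+1]≡2*[1+d]+0 (drops u (y ∷ xs))) (s≤s ih)
    ... | false | true  | ih =
      subst (suc (changes u (y ∷ xs)) ≤_) (sym (+-suc (2 * drops u (y ∷ xs)) 0)) (s≤s ih)

  changes≤2*drops+1 : ∀ xs → changes u xs ≤ 2 * drops u xs + 1
  changes≤2*drops+1 [] = z≤n
  changes≤2*drops+1 (x ∷ xs) = ≤-trans (changes≤2*drops+start x xs) (+-monoʳ-≤ _ (start≤1 x))

module _ {A : Set} {R : A → A → Set} (R-trans : Transitive R) (u : A → Bool) where

  private
    skip : ∀ {x y ys} → Linked R (x ∷ y ∷ ys) → Linked R (x ∷ ys)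
    skip {ys = []} _ = [-]
    skip {ys = _ ∷ _} (r ∷ r′ ∷ rs) = R-trans r r′ ∷ rs

    ∷-fibre⁺ : ∀ k {x} xs → u x ≡ k → Linked R (x ∷ xs) →
               Linked (λ a b → u a ≡ u b × R a b) (x ∷ fibre u k xs)
    ∷-fibre⁺ k [] _ _ = [-]
    ∷-fibre⁺ true (y ∷ ys) ux (r ∷ rs) with u y in uy
    ... | true  = (trans ux (sym uy) , r) ∷ ∷-fibre⁺ true ys uy rs
    ... | false = ∷-fibre⁺ true ys ux (skip (r ∷ rs))
    ∷-fibre⁺ false (y ∷ ys) ux (r ∷ rs) with u y in uy
    ... | true  = ∷-fibre⁺ false ys ux (skip (r ∷ rs))
    ... | false = (trans ux (sym uy) , r) ∷ ∷-fibre⁺ false ys uy rs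

  fibre⁺ : ∀ k {xs} → Linked R xs → Linked (λ a b → u a ≡ u b × R a b) (fibre u k xs)
  fibre⁺ k {[]} _ = []
  fibre⁺ true {x ∷ xs} rs with u x in ux
  ... | true  = ∷-fibre⁺ true xs ux rs
  ... | false = fibre⁺ true (Linked.tail rs)
  fibre⁺ false {x ∷ xs} rs with u x in ux
  ... | true  = fibre⁺ false (Linked.tail rs)
  ... | false = ∷-fibre⁺ false xs ux rs

module _ {A : Set} (_≟_ : DecidableEquality A) where

  dedupAfter : A → List A → List A
  dedupAfter x [] = []
  dedupAfter x (y ∷ ys) with x ≟ y
  ... | yes _ = dedupAfter x ys
  ... | no _  = y ∷ dedupAfter y ys

  countAdjacent-dedupAfter : ∀ {P : A → A → Bool} → (∀ x → P x x ≡ false) →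
    ∀ x xs → countAdjacent P (x ∷ dedupAfter x xs) ≡ countAdjacent P (x ∷ xs)
  countAdjacent-dedupAfter P-irrefl x [] = refl
  countAdjacent-dedupAfter {P} P-irrefl x (y ∷ ys) with x ≟ y
  ... | yes refl rewrite P-irrefl x = countAdjacent-dedupAfter P-irrefl x ys
  ... | no _ with P x y
  ...   | true  = cong suc (countAdjacent-dedupAfter P-irrefl y ys)
  ...   | false = countAdjacent-dedupAfter P-irrefl y ys

  dedupAfter⁺ : ∀ {R : A → A → Set} x xs → Linked R (x ∷ xs) →
                Linked (λ a b → R a b × a ≢ b) (x ∷ dedupAfter x xs)
  dedupAfter⁺ x [] _ = [-]
  dedupAfter⁺ x (y ∷ ys) (r ∷ rs) with x ≟ y
  ... | yes refl = dedupAfter⁺ x ys rs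
  ... | no x≢y   = (r , x≢y) ∷ dedupAfter⁺ y ys rs

_<ᵗ_ : ∀ {n} → Tuple n → Tuple n → Set
α <ᵗ β = α ≤ᵗ β × α ≢ β

≤ᵗ-trans : ∀ {n} → Transitive (_≤ᵗ_ {n})
≤ᵗ-trans = Pointwise.trans ≤ᵇ-trans

≤ᵗ-antisym : ∀ {n} {α β : Tuple n} → α ≤ᵗ β → β ≤ᵗ α → α ≡ β
≤ᵗ-antisym [] [] = refl
≤ᵗ-antisym (a ∷ as) (b ∷ bs) = cong₂ Vec._∷_ (≤ᵇ-antisym a b) (≤ᵗ-antisym as bs)

<ᵗ-trans : ∀ {n} → Transitive (_<ᵗ_ {n})
<ᵗ-trans (α≤β , α≢β) (β≤γ , _) =
  ≤ᵗ-trans α≤β β≤γ , λ { refl → α≢β (≤ᵗ-antisym α≤β β≤γ) }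

strictlyIncreasing⇒chain : ∀ {n} {C : List (Tuple n)} → Linked _<ᵗ_ C → IsIncreasingChain C
strictlyIncreasing⇒chain C↑ = Linked.map proj₁ C↑ , AllPairs.map proj₂ (Linked⇒AllPairs <ᵗ-trans C↑)

dC≡countAdjacent : ∀ {m n} (F : System m n) C → dC F C ≡ countAdjacent (λ α β → isYes (jump? F α β)) C
dC≡countAdjacent F [] = refl
dC≡countAdjacent F (α ∷ []) = refl
dC≡countAdjacent F (α ∷ β ∷ C) with isYes (jump? F α β) | dC≡countAdjacent F (β ∷ C)
... | true  | ih = cong suc ih
... | false | ih = ih

drops≤decrease : ∀ {n} {f : BF n} {d} → IsDecrease (single f) d →
                 ∀ {xs} → Linked _≤ᵗ_ xs → drops f xs ≤ d
drops≤decrease _ {[]} _ = z≤n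
drops≤decrease {n} {f} {d} (_ , maximal) {x ∷ xs} xs↑ = begin
  drops f (x ∷ xs)                ≡⟨ sym (countAdjacent-dedupAfter _≟ᵗ_ (∧-inverseʳ ∘ f) x xs) ⟩
  drops f C                       ≤⟨ countAdjacent-mono drop⇒jump C↑ ⟩
  countAdjacent jumps C           ≡⟨ sym (dC≡countAdjacent (single f) C) ⟩
  dC (single f) C                 ≤⟨ maximal C (strictlyIncreasing⇒chain C↑) ⟩
  d                               ∎
  where
  open ≤-Reasoning
  _≟ᵗ_ : DecidableEquality (Tuple n)
  _≟ᵗ_ = ≡-dec Bool._≟_
  C : List (Tuple n)
  C = x ∷ dedupAfter _≟ᵗ_ x xs
  C↑ : Linked _<ᵗ_ C
  C↑ = dedupAfter⁺ _≟ᵗ_ x xs xs↑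
  jumps : Tuple n → Tuple n → Bool
  jumps α β = isYes (jump? (single f) α β)
  drop⇒jump : ∀ {α β} → α <ᵗ β → T (f α ∧ not (f β)) → T (jumps α β)
  drop⇒jump {α} {β} (α≤β , _) _ with f α | f β
  ... | true | false = fromWitness (α≤β , zero , refl , refl)

changes≤2*decrease+1 : ∀ {n} {f : BF n} {d} → IsDecrease (single f) d →
                       ∀ {xs} → Linked _≤ᵗ_ xs → changes f xs ≤ 2 * d + 1
changes≤2*decrease+1 {f = f} f-decrease {xs} xs↑ =
  ≤-trans (changes≤2*drops+1 f xs) (+-monoˡ-≤ 1 (*-monoʳ-≤ 2 (drops≤decrease f-decrease xs↑)))

module _ {B : Basis} {n : ℕ} where

  gateArgs : ∀ {s} → Circuit B n s → (g : Gate B s) → Tuple n → Tuple (arity g)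
  gateArgs c g α = Vec.map (lookup (eval c α)) (inputs g)

  gateValue : ∀ {s} → Circuit B n s → Gate B s → Tuple n → Bool
  gateValue c g α = kindFun (kind g) (gateArgs c g α)

  Increasing : ∀ {s} → Circuit B n s → List (Tuple n) → Set
  Increasing c = Linked (λ α β → eval c α ≤ᵗ eval c β)

  nodeDrops : ∀ {s} → Circuit B n s → List (Tuple n) → ℕ
  nodeDrops c = countAdjacent (λ α β → isNo (eval c α ≤ᵗ? eval c β))

  gateArgs-mono : ∀ {s} (c : Circuit B n s) g {α β} →
                  eval c α ≤ᵗ eval c β → gateArgs c g α ≤ᵗ gateArgs c g β
  gateArgs-mono c g αβ =
    Pointwise.map⁺ {_∼₁_ = _≡_} (λ { refl → Pointwise.lookup αβ _ }) (Pointwise.refl refl)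

  increasing⇒nodeDrops≡0 : ∀ {s} {c : Circuit B n s} {xs} → Increasing c xs → nodeDrops c xs ≡ 0
  increasing⇒nodeDrops≡0 xs↑ = countAdjacent≡0 (Linked.map (λ αβ drop → toWitnessFalse drop αβ) xs↑)

  dC≤nodeDrops : ∀ {s m} {c : Circuit B n s} {F : System m n} → Realizes c F →
                 ∀ {C} → Linked _≤ᵗ_ C → dC F C ≤ nodeDrops c C
  dC≤nodeDrops {c = c} {F} c-realizes {C} C↑ = begin
    dC F C                                           ≡⟨ dC≡countAdjacent F C ⟩
    countAdjacent (λ α β → isYes (jump? F α β)) C   ≤⟨ countAdjacent-mono (λ _ → jump⇒drop) C↑ ⟩
    nodeDrops c C                                    ∎
    where
    open ≤-Reasoning
    true≰false : ¬ true Bool.≤ false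
    true≰false ()
    jump⇒drop : ∀ {α β} → T (isYes (jump? F α β)) → T (isNo (eval c α ≤ᵗ? eval c β))
    jump⇒drop {α} {β} jump with toWitness jump
    ... | _ , j , Fα , Fβ with c-realizes j
    ...   | v , c≗F = fromWitnessFalse λ αβ →
          true≰false (subst₂ Bool._≤_ (trans (c≗F α) Fα) (trans (c≗F β) Fβ) (Pointwise.lookup αβ v))

  ▷-increasing : ∀ {s} {c : Circuit B n s} {a} {g : BF a} (g-mono : Monotone g) ins {xs} →
                 Increasing c xs → Increasing (c ▷ gate a (mono g g-mono) ins) xs
  ▷-increasing {c = c} g-mono ins =
    Linked.map (λ αβ → g-mono _ _ (gateArgs-mono c (gate _ (mono _ g-mono) ins) αβ) ∷ αβ)

  ▷-increasing-fibre : ∀ {s} {c : Circuit B n s} g k {xs} →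
                       Increasing c xs → Increasing (c ▷ g) (fibre (gateValue c g) k xs)
  ▷-increasing-fibre {c = c} g k xs↑ =
    Linked.map (λ (same , αβ) → ≤ᵇ-reflexive same ∷ αβ) (fibre⁺ ≤ᵗ-trans (gateValue c g) k xs↑)

data Extension {B n} : ∀ {s₀ s} → Circuit B n s₀ → Circuit B n s → ℕ → Set where
  done : ∀ {s} {c : Circuit B n s} → Extension c c 0
  _◅_  : ∀ {s₀ s w} {c₀ : Circuit B n s₀} {c : Circuit B n s} (g : Gate B s₀) →
         Extension (c₀ ▷ g) c w → Extension c₀ c (weight (kind g) + w)

extension-▷ : ∀ {B n s₀ s w} {c₀ : Circuit B n s₀} {c : Circuit B n s} →
              Extension c₀ c w → (g : Gate B s) → Extension c₀ (c ▷ g) (w + weight (kind g))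
extension-▷ done g = subst (Extension _ _) (+-identityʳ (weight (kind g))) (g ◅ done)
extension-▷ (g′ ◅ ext) g =
  subst (Extension _ _) (sym (+-assoc (weight (kind g′)) _ _)) (g′ ◅ extension-▷ ext g)

inputsOnly-extension : ∀ {B n s} (c : Circuit B n s) → Extension inputsOnly c (invCount c)
inputsOnly-extension inputsOnly = done
inputsOnly-extension (c ▷ g) =
  subst (Extension _ _) (+-comm (invCount c) (weight (kind g))) (extension-▷ (inputsOnly-extension c) g)

module _ {B : Basis} (K : ℕ) (changes≤K : ∀ i {xs} → Linked _≤ᵗ_ xs → changes (ω B i) xs ≤ K)
         {n : ℕ} where

  nodeDrops+K≤K*2^w : ∀ {s₀ s w} {c₀ : Circuit B n s₀} {c : Circuit B n s} → Extension c₀ c w →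
                      ∀ {xs} → Increasing c₀ xs → nodeDrops c xs + K ≤ K * 2 ^ w
  nodeDrops+K≤K*2^w done xs↑ rewrite increasing⇒nodeDrops≡0 xs↑ = ≤-reflexive (sym (*-identityʳ K))
  nodeDrops+K≤K*2^w (gate _ (mono g g-mono) ins ◅ ext) xs↑ =
    nodeDrops+K≤K*2^w ext (▷-increasing g-mono ins xs↑)
  nodeDrops+K≤K*2^w {c₀ = c₀} {c} (_◅_ {w = w} g@(gate _ (omega i) _) ext) {xs} xs↑ = begin
    nodeDrops c xs + K                        ≤⟨ +-monoˡ-≤ K (countAdjacent-fibres _ u xs) ⟩
    D false + D true + changes u xs + K       ≤⟨ +-monoˡ-≤ K (+-monoʳ-≤ (D false + D true) u-changes≤K) ⟩
    D false + D true + K + K                  ≡⟨ regroup (D false) (D true) K ⟩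
    (D false + K) + (D true + K)              ≤⟨ +-mono-≤ (IH false) (IH true) ⟩
    K * 2 ^ w + K * 2 ^ w                     ≡⟨ double K (2 ^ w) ⟩
    K * 2 ^ suc w                             ∎
    where
    open ≤-Reasoning
    u : Tuple n → Bool
    u = gateValue c₀ g
    D : Bool → ℕ
    D k = nodeDrops c (fibre u k xs)
    IH : ∀ k → D k + K ≤ K * 2 ^ w
    IH k = nodeDrops+K≤K*2^w ext (▷-increasing-fibre g k xs↑)
    u-changes≤K : changes u xs ≤ K
    u-changes≤K = begin
      changes u xs                               ≡⟨ sym (countAdjacent-map _ (gateArgs c₀ g) xs) ⟩
      changes (ω B i) (map (gateArgs c₀ g) xs)
        ≤⟨ changes≤K i (map⁺ (Linked.map (gateArgs-mono c₀ g) xs↑)) ⟩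
      K                                          ∎
    regroup : ∀ a b k → a + b + k + k ≡ (a + k) + (b + k)
    regroup = solve-∀
    double : ∀ k x → k * x + k * x ≡ k * (2 * x)
    double = solve-∀

  nodeDrops+K≤K*2^invCount : ∀ {s} (c : Circuit B n s) {xs} → Linked _≤ᵗ_ xs →
                             nodeDrops c xs + K ≤ K * 2 ^ invCount c
  nodeDrops+K≤K*2^invCount c = nodeDrops+K≤K*2^w (inputsOnly-extension c)

power-of-two-between : ∀ n → Σ ℕ λ j → suc n ≤ 2 ^ j × 2 ^ j ≤ 2 * suc n
power-of-two-between zero = 0 , ≤-refl , s≤s z≤n
power-of-two-between (suc n) with power-of-two-between n
... | j , n<2^j , 2^j≤2n+2 with 2 + n ≤? 2 ^ j
...   | yes n+1<2^j = j , n+1<2^j , ≤-trans 2^j≤2n+2 (*-monoʳ-≤ 2 (n≤1+n (suc n)))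
...   | no  n+1≮2^j = suc j , ≤-trans (2+n≤2*[1+n] n) (≤-reflexive (sym 2^[1+j]≡2*[1+n]))
                            , ≤-trans (≤-reflexive 2^[1+j]≡2*[1+n]) (*-monoʳ-≤ 2 (n≤1+n (suc n)))
  where
  2^[1+j]≡2*[1+n] : 2 ^ suc j ≡ 2 * suc n
  2^[1+j]≡2*[1+n] = cong (2 *_) (≤-antisym (≤-pred (≰⇒> n+1≮2^j)) n<2^j)
  2+n≤2*[1+n] : ∀ k → 2 + k ≤ 2 * suc k
  2+n≤2*[1+n] k = ≤-trans (+-monoʳ-≤ 2 (m≤n*m k 2)) (≤-reflexive (sym (*-suc 2 k)))

2^⌈log₂[1+n]⌉≤2*[1+n] : ∀ n → 2 ^ ⌈log₂ (suc n) ⌉ ≤ 2 * suc n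
2^⌈log₂[1+n]⌉≤2*[1+n] n with power-of-two-between n
... | j , n<2^j , 2^j≤2n+2 = ≤-trans (^-monoʳ-≤ 2 ⌈log₂[1+n]⌉≤j) 2^j≤2n+2
  where
  ⌈log₂[1+n]⌉≤j : ⌈log₂ (suc n) ⌉ ≤ j
  ⌈log₂[1+n]⌉≤j = subst (⌈log₂ suc n ⌉ ≤_) (⌈log₂2^n⌉≡n j) (⌈log₂⌉-mono-≤ n<2^j)

2^⌈log₂[d+1]⌉≤K*2^[I+1] : ∀ d K I → suc d ≤ K * 2 ^ I → 2 ^ ⌈log₂ (d + 1) ⌉ ≤ K * 2 ^ (I + 1)
2^⌈log₂[d+1]⌉≤K*2^[I+1] d K I d<K*2^I = begin
  2 ^ ⌈log₂ (d + 1) ⌉   ≡⟨ cong (λ k → 2 ^ ⌈log₂ k ⌉) (+-comm d 1) ⟩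
  2 ^ ⌈log₂ (suc d) ⌉   ≤⟨ 2^⌈log₂[1+n]⌉≤2*[1+n] d ⟩
  2 * suc d             ≤⟨ *-monoʳ-≤ 2 d<K*2^I ⟩
  2 * (K * 2 ^ I)       ≡⟨ double K (2 ^ I) ⟩
  K * (2 ^ I * 2 ^ 1)   ≡⟨ cong (K *_) (sym (^-distribˡ-+-* 2 I 1)) ⟩
  K * 2 ^ (I + 1)       ∎
  where
  open ≤-Reasoning
  double : ∀ k x → 2 * (k * x) ≡ k * (x * 2 ^ 1)
  double = solve-∀

lemma2 : (B : Basis) → 1 ≤ p B → (∀ i → ¬ Monotone (ω B i))
         → (dω : Fin (p B) → ℕ) → (∀ i → IsDecrease (single (ω B i)) (dω i))
         → (r : ℕ) → IsMaxOf dω r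
         → (n m : ℕ) (F : System m n)
         → (dF : ℕ) → IsDecrease F dF
         → (I : ℕ) → IsInversionComplexity B F I
         → 2 ^ ⌈log₂ (dF + 1) ⌉ ≤ (2 * r + 1) * 2 ^ (I + 1)
lemma2 B _ _ _ dω-decrease r (_ , dω≤r) _ _ _ dF ((C , (C↑ , _) , dC≡dF) , _)
       I ((_ , c , c-realizes , invCount≡I) , _) = 2^⌈log₂[d+1]⌉≤K*2^[I+1] dF K I (begin
  suc dF              ≡⟨ +-comm 1 dF ⟩
  dF + 1              ≤⟨ +-mono-≤ dF≤nodeDrops (m≤n+m 1 (2 * r)) ⟩
  nodeDrops c C + K   ≤⟨ nodeDrops+K≤K*2^invCount K changes≤K c C↑ ⟩
  K * 2 ^ invCount c  ≡⟨ cong (λ w → K * 2 ^ w) invCount≡I ⟩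
  K * 2 ^ I           ∎)
  where
  open ≤-Reasoning
  K : ℕ
  K = 2 * r + 1
  changes≤K : ∀ i {xs} → Linked _≤ᵗ_ xs → changes (ω B i) xs ≤ K
  changes≤K i xs↑ =
    ≤-trans (changes≤2*decrease+1 (dω-decrease i) xs↑) (+-monoˡ-≤ 1 (*-monoʳ-≤ 2 (dω≤r i)))
  dF≤nodeDrops : dF ≤ nodeDrops c C
  dF≤nodeDrops = subst (_≤ nodeDrops c C) dC≡dF (dC≤nodeDrops c-realizes C↑)
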